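{- Let $w_{1},w_{2},w_{3}$ be any odd positive integers and $n\ge0$ an integer. Then \begin{align*} &\sum_{k+l+m=n}\binom{n}{k,l,m}T_{k}(w_{1}-1)T_{l}(w_{2}-1)T_{m}(w_{3}-1)w_{3}^{k}w_{1}^{l}w_{2}^{m}\\ =&\sum_{k+l+m=n}\binom{n}{k,l,m}T_{k}(w_{1}-1)T_{l}(w_{3}-1)T_{m}(w_{2}-1)w_{2}^{k}w_{1}^{l}w_{3}^{m}. \end{align*}
   Context: For integers $k,N\ge0$, $T_{k}(N)=\sum_{i=0}^{N}(-1)^{i}i^{k}$, with the convention $0^0=1$. Sums $\sum_{k+l+m=n}$ run over all nonnegative integers $k,l,m$ with $k+l+m=n$, and $\binom{n}{k,l,m}=\frac{n!}{k!\,l!\,m!}$. -}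

module Defs where

open import Data.Nat as ℕ using (ℕ; zero; suc; _∸_; _!)
open import Data.Nat.Properties using (_!≢0; m*n≢0)
open import Data.Nat.DivMod using (_/_)
open import Data.Integer as ℤ using (ℤ; +_; -_)
open import Data.Product using (Σ)
open import Relation.Binary.PropositionalEquality using (_≡_)
open import Data.List using (List; []; _∷_; map; concatMap)

sgn : ℕ → ℤ → ℤ
sgn zero    x = x
sgn (suc i) x = - sgn i x

-- T_k(N) = Σ_{i=0}^{N} (-1)^i i^k   (with 0^0 = 1, as ℕ._^_ gives)
T : ℕ → ℕ → ℤ
T k zero    = + (0 ℕ.^ k)
T k (suc N) = T k N ℤ.+ sgn (suc N) (+ (suc N ℕ.^ k))

multinomial : ℕ → ℕ → ℕ → ℕ → ℕ
multinomial n k l m =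
  (n ! / (k ! ℕ.* l ! ℕ.* m !)) {{m*n≢0 (k ! ℕ.* l !) (m !) {{m*n≢0 (k !) (l !) {{k !≢0}} {{l !≢0}}}} {{m !≢0}}}}

range : ℕ → List ℕ
range zero    = 0 ∷ []
range (suc n) = 0 ∷ map suc (range n)

sumList : List ℤ → ℤ
sumList []       = + 0
sumList (x ∷ xs) = x ℤ.+ sumList xs

sumTriples : ℕ → (ℕ → ℕ → ℕ → ℤ) → ℤ
sumTriples n f =
  sumList (concatMap (λ k → map (λ l → f k l (n ∸ k ∸ l)) (range (n ∸ k))) (range n))

Odd : ℕ → Set
Odd w = Σ ℕ (λ j → w ≡ 2 ℕ.* j ℕ.+ 1)

module Submission where

-- Write g(e) = e^n.  Expanding every T_k(N) c^k as the
-- alternating sum Σ_{i≤N} (-1)^i (i c)^k and applying the trinomial theorem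
-- turns the left-hand side into the triple alternating sum
--   Tri w₁ w₂ w₃ g 0 = Σ_{a<w₁, b<w₂, c<w₃} (-1)^(a+b+c) g(a w₃ + b w₁ + c w₂),
-- and the right-hand side into Tri w₁ w₃ w₂ g 0, the same sum with w₂ and w₃
-- exchanged.  This symmetry holds for every g : ℕ → ℤ.  Tri is a composite
-- of three operators  Alt N c h e = Σ_{a≤N} (-1)^a h(e + a c).  With
-- Pair c h e = h e + h (e + c)  (the operator 1 + shift by c) one has, for
-- odd w, the telescoping identity  Pair c ∘ Alt (w-1) c = Pair (w c), and all
-- these operators commute.  So applying Pair w₂, Pair w₁, Pair w₃ to either
-- side yields Pair (w₁w₂) ∘ Pair (w₂w₃) ∘ Pair (w₃w₁) applied to g.  Each
-- Pair c with c > 0 is injective on functions vanishing beyond some bound,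
-- and truncating g far out does not change the values at 0.

open import Defs
open import Function using (_∘_)
open import Data.Nat as ℕ using (ℕ; zero; suc; _∸_; _^_; _≤_; _<_; z≤n; _≤?_; _!)
import Data.Nat.Properties as ℕP
open import Data.Nat.Combinatorics using (_C_; nCk≡n!/k![n-k]!; k![n∸k]!∣n!)
open import Data.Nat.DivMod using (_/_; m/n*n≡m; m*n/n≡m)
open import Data.Integer using (ℤ; +_; -_; _+_; _*_; 0ℤ)
import Data.Integer.Properties as ℤP
open import Data.Integer.Tactic.RingSolver using (solve-∀)
import Data.Nat.Tactic.RingSolver as ℕSolver
open import Data.Fin as Fin using (Fin; toℕ)
open import Data.Fin.Properties using (toℕ≤pred[n]; toℕ-inject₁; toℕ-fromℕ)
open import Data.List using (List; []; _∷_; map; concatMap; _++_)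
import Data.List.Properties as ListP
open import Data.Product using (_,_)
open import Data.Empty using (⊥-elim)
open import Algebra.Bundles using (AbelianGroup)
open import Algebra.Properties.Group (AbelianGroup.group ℤP.+-0-abelianGroup) using (∙-cancelʳ)
open import Relation.Nullary using (yes; no)
open import Relation.Binary.PropositionalEquality
open import Algebra.Properties.Semiring.Sum ℤP.+-*-semiring
  using (sum; sum-syntax; sum⁺-syntax; sum-cong-≗; sum-init-last; sum-replicate-zero;
         ∑-distrib-+; ∑-comm; *-distribˡ-sum; *-distribʳ-sum)
open import Algebra.Properties.Semiring.Mult ℤP.+-*-semiring using (_×_)
open import Algebra.Properties.CommutativeSemiring.Exp ℤP.+-*-commutativeSemiring
  using (^-distrib-*) renaming (_^_ to _^ᶻ_)
import Algebra.Properties.CommutativeSemiring.Binomial ℤP.+-*-commutativeSemiring as Binomial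

open ≡-Reasoning

sgn-neg : ∀ m x → sgn m (- x) ≡ - sgn m x
sgn-neg zero    x = refl
sgn-neg (suc m) x = cong -_ (sgn-neg m x)

sgn-+ : ∀ m n x → sgn (m ℕ.+ n) x ≡ sgn m (sgn n x)
sgn-+ zero    n x = refl
sgn-+ (suc m) n x = cong -_ (sgn-+ m n x)

sgn-involutive : ∀ m x → sgn m (sgn m x) ≡ x
sgn-involutive zero    x = refl
sgn-involutive (suc m) x = begin
  - sgn m (- sgn m x)   ≡⟨ cong -_ (sgn-neg m (sgn m x)) ⟩
  - - sgn m (sgn m x)   ≡⟨ ℤP.neg-involutive _ ⟩
  sgn m (sgn m x)       ≡⟨ sgn-involutive m x ⟩
  x                     ∎

-- An even power of -1 is 1; this is where oddness of the w's enters.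
sgn-even : ∀ j x → sgn (2 ℕ.* j) x ≡ x
sgn-even j x = begin
  sgn (j ℕ.+ (j ℕ.+ 0)) x  ≡⟨ cong (λ t → sgn (j ℕ.+ t) x) (ℕP.+-identityʳ j) ⟩
  sgn (j ℕ.+ j) x          ≡⟨ sgn-+ j j x ⟩
  sgn j (sgn j x)          ≡⟨ sgn-involutive j x ⟩
  x                        ∎

sgn-*ˡ : ∀ m x y → sgn m x * y ≡ sgn m (x * y)
sgn-*ˡ zero    x y = refl
sgn-*ˡ (suc m) x y = trans (sym (ℤP.neg-distribˡ-* (sgn m x) y)) (cong -_ (sgn-*ˡ m x y))

sgn-*ʳ : ∀ m x y → x * sgn m y ≡ sgn m (x * y)
sgn-*ʳ zero    x y = refl
sgn-*ʳ (suc m) x y = trans (sym (ℤP.neg-distribʳ-* x (sgn m y))) (cong -_ (sgn-*ʳ m x y))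

sgn-distrib-+ : ∀ m x y → sgn m (x + y) ≡ sgn m x + sgn m y
sgn-distrib-+ zero    x y = refl
sgn-distrib-+ (suc m) x y = trans (cong -_ (sgn-distrib-+ m x y)) (ℤP.neg-distrib-+ (sgn m x) (sgn m y))

sgn-0 : ∀ m → sgn m 0ℤ ≡ 0ℤ
sgn-0 zero    = refl
sgn-0 (suc m) = cong -_ (sgn-0 m)

sgn-sum : ∀ m {n} (f : Fin n → ℤ) → sgn m (sum f) ≡ ∑[ i < n ] sgn m (f i)
sgn-sum m {zero}  f = sgn-0 m
sgn-sum m {suc n} f =
  trans (sgn-distrib-+ m _ _) (cong (λ t → sgn m (f Fin.zero) + t) (sgn-sum m (f ∘ Fin.suc)))

altSum : ℕ → (ℕ → ℤ) → ℤ
altSum N f = ∑[ i ≤ N ] sgn (toℕ i) (f (toℕ i))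

altSum-cong≤ : ∀ N {f g : ℕ → ℤ} → (∀ i → i ≤ N → f i ≡ g i) → altSum N f ≡ altSum N g
altSum-cong≤ N eq = sum-cong-≗ {suc N} (λ i → cong (sgn (toℕ i)) (eq (toℕ i) (toℕ≤pred[n] i)))

altSum-cong : ∀ N {f g : ℕ → ℤ} → (∀ i → f i ≡ g i) → altSum N f ≡ altSum N g
altSum-cong N eq = altSum-cong≤ N (λ i _ → eq i)

altSum-zero : ∀ N (f : ℕ → ℤ) → (∀ i → f i ≡ 0ℤ) → altSum N f ≡ 0ℤ
altSum-zero N f eq =
  trans (sum-cong-≗ {suc N} (λ i → trans (cong (sgn (toℕ i)) (eq (toℕ i))) (sgn-0 (toℕ i))))
        (sum-replicate-zero (suc N))

altSum-+ : ∀ N (f g : ℕ → ℤ) → altSum N f + altSum N g ≡ altSum N (λ i → f i + g i)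
altSum-+ N f g = begin
  altSum N f + altSum N g
    ≡⟨ ∑-distrib-+ {suc N} (λ i → sgn (toℕ i) (f (toℕ i))) (λ i → sgn (toℕ i) (g (toℕ i))) ⟨
  ∑[ i ≤ N ] (sgn (toℕ i) (f (toℕ i)) + sgn (toℕ i) (g (toℕ i)))
    ≡⟨ sum-cong-≗ {suc N} (λ i → sgn-distrib-+ (toℕ i) (f (toℕ i)) (g (toℕ i))) ⟨
  altSum N (λ i → f i + g i)   ∎

altSum-*ˡ : ∀ N y (f : ℕ → ℤ) → y * altSum N f ≡ altSum N (λ i → y * f i)
altSum-*ˡ N y f = trans (*-distribˡ-sum {suc N} y (λ i → sgn (toℕ i) (f (toℕ i))))
  (sum-cong-≗ {suc N} (λ i → sgn-*ʳ (toℕ i) y (f (toℕ i))))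

altSum-*ʳ : ∀ N y (f : ℕ → ℤ) → altSum N f * y ≡ altSum N (λ i → f i * y)
altSum-*ʳ N y f = trans (*-distribʳ-sum {suc N} y (λ i → sgn (toℕ i) (f (toℕ i))))
  (sum-cong-≗ {suc N} (λ i → sgn-*ˡ (toℕ i) (f (toℕ i)) y))

altSum-suc : ∀ N (f : ℕ → ℤ) → altSum (suc N) f ≡ f 0 + - altSum N (f ∘ suc)
altSum-suc N f = cong (λ t → f 0 + t) (sym (sgn-sum 1 {suc N} (λ i → sgn (toℕ i) (f (suc (toℕ i))))))

altSum-telescope : ∀ N (f : ℕ → ℤ) → altSum N f + altSum N (f ∘ suc) ≡ f 0 + sgn N (f (suc N))
altSum-telescope zero    f = cong₂ _+_ (ℤP.+-identityʳ (f 0)) (ℤP.+-identityʳ (f 1))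
altSum-telescope (suc N) f = begin
  altSum (suc N) f + altSum (suc N) (f ∘ suc)
    ≡⟨ cong₂ _+_ (altSum-suc N f) (altSum-suc N (f ∘ suc)) ⟩
  (f 0 + - altSum N (f ∘ suc)) + (f 1 + - altSum N (f ∘ suc ∘ suc))
    ≡⟨ cancel (f 0) (f 1) _ _ _ (altSum-telescope N (f ∘ suc)) ⟩
  f 0 + - sgn N (f (suc (suc N)))   ∎
  where
  cancel : ∀ a b p q s → p + q ≡ b + s → (a + - p) + (b + - q) ≡ a + - s
  cancel a b p q s p+q≡b+s = begin
    (a + - p) + (b + - q)   ≡⟨ regroup a b p q ⟩
    (a + b) + - (p + q)     ≡⟨ cong (λ t → (a + b) + - t) p+q≡b+s ⟩
    (a + b) + - (b + s)     ≡⟨ simplify a b s ⟩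
    a + - s                 ∎
    where
    regroup : ∀ a b p q → (a + - p) + (b + - q) ≡ (a + b) + - (p + q)
    regroup = solve-∀
    simplify : ∀ a b s → (a + b) + - (b + s) ≡ a + - s
    simplify = solve-∀

sumList-++ : ∀ xs ys → sumList (xs ++ ys) ≡ sumList xs + sumList ys
sumList-++ []       ys = sym (ℤP.+-identityˡ _)
sumList-++ (x ∷ xs) ys = trans (cong (λ t → x + t) (sumList-++ xs ys)) (sym (ℤP.+-assoc x _ _))

sumList-concatMap : ∀ (g : ℕ → List ℤ) xs →
  sumList (concatMap g xs) ≡ sumList (map (sumList ∘ g) xs)
sumList-concatMap g []       = refl
sumList-concatMap g (x ∷ xs) =
  trans (sumList-++ (g x) _) (cong (λ t → sumList (g x) + t) (sumList-concatMap g xs))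

sumList-range : ∀ n (f : ℕ → ℤ) → sumList (map f (range n)) ≡ ∑[ i ≤ n ] f (toℕ i)
sumList-range zero    f = refl
sumList-range (suc n) f =
  cong (λ t → f 0 + t) (trans (cong sumList (sym (ListP.map-∘ (range n)))) (sumList-range n (f ∘ suc)))

∑△ : ℕ → (ℕ → ℕ → ℤ) → ℤ
∑△ n G = ∑[ k ≤ n ] ∑[ l ≤ n ∸ toℕ k ] G (toℕ k) (toℕ l)

∑△-cong : ∀ n {G H : ℕ → ℕ → ℤ} → (∀ k l → G k l ≡ H k l) → ∑△ n G ≡ ∑△ n H
∑△-cong n eq = sum-cong-≗ {suc n} (λ k → sum-cong-≗ {suc (n ∸ toℕ k)} (λ l → eq (toℕ k) (toℕ l)))

sumTriples-∑△ : ∀ n F → sumTriples n F ≡ ∑△ n (λ k l → F k l (n ∸ k ∸ l))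
sumTriples-∑△ n F = begin
  sumTriples n F
    ≡⟨ sumList-concatMap _ (range n) ⟩
  sumList (map (λ k → sumList (map (λ l → F k l (n ∸ k ∸ l)) (range (n ∸ k)))) (range n))
    ≡⟨ sumList-range n _ ⟩
  ∑[ k ≤ n ] sumList (map (λ l → F (toℕ k) l (n ∸ toℕ k ∸ l)) (range (n ∸ toℕ k)))
    ≡⟨ sum-cong-≗ {suc n} (λ k → sumList-range (n ∸ toℕ k) (λ l → F (toℕ k) l (n ∸ toℕ k ∸ l))) ⟩
  ∑△ n (λ k l → F k l (n ∸ k ∸ l))   ∎

∑△-comm : ∀ n m (G : Fin m → ℕ → ℕ → ℤ) →
  ∑△ n (λ k l → sum (λ i → G i k l)) ≡ sum (λ i → ∑△ n (G i))
∑△-comm n m G = begin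
  ∑[ k ≤ n ] ∑[ l ≤ n ∸ toℕ k ] ∑[ i < m ] G i (toℕ k) (toℕ l)
    ≡⟨ sum-cong-≗ {suc n} (λ k → ∑-comm {suc (n ∸ toℕ k)} {m} (λ l i → G i (toℕ k) (toℕ l))) ⟩
  ∑[ k ≤ n ] ∑[ i < m ] ∑[ l ≤ n ∸ toℕ k ] G i (toℕ k) (toℕ l)
    ≡⟨ ∑-comm {suc n} {m} (λ k i → ∑[ l ≤ n ∸ toℕ k ] G i (toℕ k) (toℕ l)) ⟩
  ∑[ i < m ] ∑△ n (G i)   ∎

sgn-∑△ : ∀ s n G → sgn s (∑△ n G) ≡ ∑△ n (λ k l → sgn s (G k l))
sgn-∑△ s n G = trans (sgn-sum s {suc n} (λ k → ∑[ l ≤ n ∸ toℕ k ] G (toℕ k) (toℕ l)))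
  (sum-cong-≗ {suc n} (λ k → sgn-sum s {suc (n ∸ toℕ k)} (λ l → G (toℕ k) (toℕ l))))

∑△-altSum : ∀ n N (H : ℕ → ℕ → ℕ → ℤ) →
  ∑△ n (λ k l → altSum N (λ i → H i k l)) ≡ altSum N (λ i → ∑△ n (H i))
∑△-altSum n N H =
  trans (∑△-comm n (suc N) (λ i k l → sgn (toℕ i) (H (toℕ i) k l)))
        (sum-cong-≗ {suc N} (λ i → sym (sgn-∑△ (toℕ i) n (H (toℕ i)))))

sum-snoc : ∀ N (f : ℕ → ℤ) → ∑[ i ≤ suc N ] f (toℕ i) ≡ ∑[ i ≤ N ] f (toℕ i) + f (suc N)
sum-snoc N f = trans (sum-init-last (f ∘ toℕ))
  (cong₂ _+_ (sum-cong-≗ {suc N} (λ i → cong f (toℕ-inject₁ i))) (cong f (toℕ-fromℕ (suc N))))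

T-altSum : ∀ k N → T k N ≡ altSum N (λ i → + (i ^ k))
T-altSum k zero    = sym (ℤP.+-identityʳ _)
T-altSum k (suc N) = sym (trans (sum-snoc N (λ i → sgn i (+ (i ^ k))))
                                (cong (_+ sgn (suc N) (+ (suc N ^ k))) (sym (T-altSum k N))))

-- The trinomial theorem over ℤ

pos-^ : ∀ m k → + (m ^ k) ≡ (+ m) ^ᶻ k
pos-^ m zero    = refl
pos-^ m (suc k) = trans (ℤP.pos-* m (m ^ k)) (cong (+ m *_) (pos-^ m k))

×-is-* : ∀ n x → n × x ≡ + n * x
×-is-* zero    x = sym (ℤP.*-zeroˡ x)
×-is-* (suc n) x = trans (cong (λ t → x + t) (×-is-* n x)) (sym (ℤP.suc-* (+ n) x))

binomial : ∀ n x y → (x + y) ^ᶻ n ≡ ∑[ k ≤ n ] (+ (n C toℕ k) * (x ^ᶻ toℕ k * y ^ᶻ (n ∸ toℕ k)))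
binomial n x y = trans (Binomial.theorem n x y)
  (sum-cong-≗ {suc n} (λ k → ×-is-* (n C toℕ k) (x ^ᶻ toℕ k * y ^ᶻ (n ∸ toℕ k))))

C-factorials : ∀ {n k} → k ≤ n → (n C k) ℕ.* (k ! ℕ.* (n ∸ k) !) ≡ n !
C-factorials {n} {k} k≤n =
  trans (cong (ℕ._* (k ! ℕ.* (n ∸ k) !)) (nCk≡n!/k![n-k]! k≤n))
        (m/n*n≡m {{ℕP.m*n≢0 (k !) ((n ∸ k) !) {{ℕP._!≢0 k}} {{ℕP._!≢0 (n ∸ k)}}}} (k![n∸k]!∣n! k≤n))

multinomial-C : ∀ {n k l} → k ≤ n → l ≤ n ∸ k →
  multinomial n k l (n ∸ k ∸ l) ≡ (n C k) ℕ.* ((n ∸ k) C l)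
multinomial-C {n} {k} {l} k≤n l≤n-k = begin
  (n ! / D) {{D≢0}}                                   ≡⟨ cong (λ t → (t / D) {{D≢0}}) n!≡ ⟩
  ((n C k) ℕ.* ((n ∸ k) C l) ℕ.* D / D) {{D≢0}}       ≡⟨ m*n/n≡m _ D {{D≢0}} ⟩
  (n C k) ℕ.* ((n ∸ k) C l)                           ∎
  where
  m = n ∸ k ∸ l
  D = k ! ℕ.* l ! ℕ.* m !
  D≢0 = ℕP.m*n≢0 (k ! ℕ.* l !) (m !) {{ℕP.m*n≢0 (k !) (l !) {{ℕP._!≢0 k}} {{ℕP._!≢0 l}}}} {{ℕP._!≢0 m}}
  n!≡ : n ! ≡ (n C k) ℕ.* ((n ∸ k) C l) ℕ.* D
  n!≡ = begin
    n !                                                       ≡⟨ C-factorials k≤n ⟨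
    (n C k) ℕ.* (k ! ℕ.* (n ∸ k) !)                           ≡⟨ cong (λ t → (n C k) ℕ.* (k ! ℕ.* t)) (C-factorials l≤n-k) ⟨
    (n C k) ℕ.* (k ! ℕ.* (((n ∸ k) C l) ℕ.* (l ! ℕ.* m !)))   ≡⟨ regroup (n C k) ((n ∸ k) C l) (k !) (l !) (m !) ⟩
    (n C k) ℕ.* ((n ∸ k) C l) ℕ.* D                           ∎
    where
    regroup : ∀ a b p q r → a ℕ.* (p ℕ.* (b ℕ.* (q ℕ.* r))) ≡ a ℕ.* b ℕ.* (p ℕ.* q ℕ.* r)
    regroup = ℕSolver.solve-∀

-- The trinomial theorem: apply the binomial theorem twice.
trinomial : ∀ n x y z →
  ∑△ n (λ k l → + multinomial n k l (n ∸ k ∸ l) * x ^ᶻ k * y ^ᶻ l * z ^ᶻ (n ∸ k ∸ l)) ≡ (x + y + z) ^ᶻ n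
trinomial n x y z = begin
  ∑△ n (λ k l → + multinomial n k l (n ∸ k ∸ l) * x ^ᶻ k * y ^ᶻ l * z ^ᶻ (n ∸ k ∸ l))
    ≡⟨ sum-cong-≗ {suc n} (λ k → sum-cong-≗ {suc (n ∸ toℕ k)} (λ l → split-term (toℕ≤pred[n] k) (toℕ≤pred[n] l))) ⟩
  ∑[ k ≤ n ] ∑[ l ≤ n ∸ toℕ k ] (a k * b (toℕ k) l)
    ≡⟨ sum-cong-≗ {suc n} (λ k → *-distribˡ-sum {suc (n ∸ toℕ k)} (a k) (b (toℕ k))) ⟨
  ∑[ k ≤ n ] (a k * sum (b (toℕ k)))
    ≡⟨ sum-cong-≗ {suc n} (λ k → cong (a k *_) (binomial (n ∸ toℕ k) y z)) ⟨
  ∑[ k ≤ n ] (a k * (y + z) ^ᶻ (n ∸ toℕ k))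
    ≡⟨ sum-cong-≗ {suc n} (λ k → ℤP.*-assoc (+ (n C toℕ k)) (x ^ᶻ toℕ k) ((y + z) ^ᶻ (n ∸ toℕ k))) ⟩
  ∑[ k ≤ n ] (+ (n C toℕ k) * (x ^ᶻ toℕ k * (y + z) ^ᶻ (n ∸ toℕ k)))
    ≡⟨ binomial n x (y + z) ⟨
  (x + (y + z)) ^ᶻ n
    ≡⟨ cong (_^ᶻ n) (ℤP.+-assoc x y z) ⟨
  (x + y + z) ^ᶻ n   ∎
  where
  a : Fin (suc n) → ℤ
  a k = + (n C toℕ k) * x ^ᶻ toℕ k
  b : (k : ℕ) → Fin (suc (n ∸ k)) → ℤ
  b k l = + ((n ∸ k) C toℕ l) * (y ^ᶻ toℕ l * z ^ᶻ (n ∸ k ∸ toℕ l))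
  regroup : ∀ p q x y z → p * q * x * y * z ≡ (p * x) * (q * (y * z))
  regroup = solve-∀
  split-term : ∀ {k l} → k ≤ n → l ≤ n ∸ k →
    + multinomial n k l (n ∸ k ∸ l) * x ^ᶻ k * y ^ᶻ l * z ^ᶻ (n ∸ k ∸ l)
      ≡ (+ (n C k) * x ^ᶻ k) * (+ ((n ∸ k) C l) * (y ^ᶻ l * z ^ᶻ (n ∸ k ∸ l)))
  split-term {k} {l} k≤n l≤n-k = begin
    + multinomial n k l (n ∸ k ∸ l) * x ^ᶻ k * y ^ᶻ l * z ^ᶻ (n ∸ k ∸ l)
      ≡⟨ cong (λ t → + t * x ^ᶻ k * y ^ᶻ l * z ^ᶻ (n ∸ k ∸ l)) (multinomial-C k≤n l≤n-k) ⟩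
    + ((n C k) ℕ.* ((n ∸ k) C l)) * x ^ᶻ k * y ^ᶻ l * z ^ᶻ (n ∸ k ∸ l)
      ≡⟨ cong (λ t → t * x ^ᶻ k * y ^ᶻ l * z ^ᶻ (n ∸ k ∸ l)) (ℤP.pos-* (n C k) ((n ∸ k) C l)) ⟩
    + (n C k) * + ((n ∸ k) C l) * x ^ᶻ k * y ^ᶻ l * z ^ᶻ (n ∸ k ∸ l)
      ≡⟨ regroup (+ (n C k)) _ _ _ _ ⟩
    (+ (n C k) * x ^ᶻ k) * (+ ((n ∸ k) C l) * (y ^ᶻ l * z ^ᶻ (n ∸ k ∸ l)))   ∎

odd-sgn : ∀ {w} → Odd w → ∀ x → sgn (w ∸ 1) x ≡ x
odd-sgn (j , refl) x = trans (cong (λ t → sgn t x) (ℕP.m+n∸n≡m (2 ℕ.* j) 1)) (sgn-even j x)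

odd-suc-pred : ∀ {w} → Odd w → suc (w ∸ 1) ≡ w
odd-suc-pred (j , refl) = trans (cong suc (ℕP.m+n∸n≡m (2 ℕ.* j) 1)) (ℕP.+-comm 1 (2 ℕ.* j))

odd-pos : ∀ {w} → Odd w → 0 < w
odd-pos o = subst (0 <_) (odd-suc-pred o) ℕP.0<1+n

-- Two commuting families of operators on functions ℕ → ℤ

Alt : ℕ → ℕ → (ℕ → ℤ) → ℕ → ℤ
Alt N c h e = altSum N (λ a → h (e ℕ.+ a ℕ.* c))

Pair : ℕ → (ℕ → ℤ) → ℕ → ℤ
Pair c h e = h e + h (e ℕ.+ c)

Alt-cong : ∀ N c {h h′ : ℕ → ℤ} → h ≗ h′ → Alt N c h ≗ Alt N c h′
Alt-cong N c h≗h′ e = altSum-cong N (λ a → h≗h′ (e ℕ.+ a ℕ.* c))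

Pair-cong : ∀ c {h h′ : ℕ → ℤ} → h ≗ h′ → Pair c h ≗ Pair c h′
Pair-cong c h≗h′ e = cong₂ _+_ (h≗h′ e) (h≗h′ (e ℕ.+ c))

Pair-Alt : ∀ {w} → Odd w → ∀ c h → Pair c (Alt (w ∸ 1) c h) ≗ Pair (w ℕ.* c) h
Pair-Alt {w} o c h e = begin
  Alt (w ∸ 1) c h e + Alt (w ∸ 1) c h (e ℕ.+ c)
    ≡⟨ cong (λ t → Alt (w ∸ 1) c h e + t) (altSum-cong (w ∸ 1) (λ a → cong h (ℕP.+-assoc e c (a ℕ.* c)))) ⟩
  altSum (w ∸ 1) f + altSum (w ∸ 1) (f ∘ suc)
    ≡⟨ altSum-telescope (w ∸ 1) f ⟩
  f 0 + sgn (w ∸ 1) (f (suc (w ∸ 1)))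
    ≡⟨ cong₂ _+_ (cong h (ℕP.+-identityʳ e)) (trans (odd-sgn o _) (cong f (odd-suc-pred o))) ⟩
  h e + h (e ℕ.+ w ℕ.* c)   ∎
  where
  f : ℕ → ℤ
  f a = h (e ℕ.+ a ℕ.* c)

+-right-comm : ∀ m n o → m ℕ.+ n ℕ.+ o ≡ m ℕ.+ o ℕ.+ n
+-right-comm = ℕSolver.solve-∀

Pair-Alt-comm : ∀ d N c h → Pair d (Alt N c h) ≗ Alt N c (Pair d h)
Pair-Alt-comm d N c h e = begin
  Alt N c h e + Alt N c h (e ℕ.+ d)
    ≡⟨ cong (λ t → Alt N c h e + t) (altSum-cong N (λ a → cong h (+-right-comm e d (a ℕ.* c)))) ⟩
  altSum N (λ a → h (e ℕ.+ a ℕ.* c)) + altSum N (λ a → h (e ℕ.+ a ℕ.* c ℕ.+ d))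
    ≡⟨ altSum-+ N (λ a → h (e ℕ.+ a ℕ.* c)) (λ a → h (e ℕ.+ a ℕ.* c ℕ.+ d)) ⟩
  Alt N c (Pair d h) e   ∎

Pair-comm : ∀ c d h → Pair c (Pair d h) ≗ Pair d (Pair c h)
Pair-comm c d h e = begin
  (h e + h (e ℕ.+ d)) + (h (e ℕ.+ c) + h (e ℕ.+ c ℕ.+ d))
    ≡⟨ cong (λ t → (h e + h (e ℕ.+ d)) + (h (e ℕ.+ c) + h t)) (+-right-comm e c d) ⟩
  (h e + h (e ℕ.+ d)) + (h (e ℕ.+ c) + h (e ℕ.+ d ℕ.+ c))
    ≡⟨ interchange (h e) _ _ _ ⟩
  (h e + h (e ℕ.+ c)) + (h (e ℕ.+ d) + h (e ℕ.+ d ℕ.+ c))   ∎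
  where
  interchange : ∀ a b p q → (a + b) + (p + q) ≡ (a + p) + (b + q)
  interchange = solve-∀

Pair³-reverse : ∀ a b c h → Pair a (Pair b (Pair c h)) ≗ Pair c (Pair b (Pair a h))
Pair³-reverse a b c h e = begin
  Pair a (Pair b (Pair c h)) e   ≡⟨ Pair-cong a (Pair-comm b c h) e ⟩
  Pair a (Pair c (Pair b h)) e   ≡⟨ Pair-comm a c (Pair b h) e ⟩
  Pair c (Pair a (Pair b h)) e   ≡⟨ Pair-cong c (Pair-comm a b h) e ⟩
  Pair c (Pair b (Pair a h)) e   ∎

-- The symmetry of the triple alternating sum

-- Tri x y z h e = Σ_{a<x, b<y, c<z} (-1)^(a+b+c) h(e + a z + b x + c y)
Tri : ℕ → ℕ → ℕ → (ℕ → ℤ) → ℕ → ℤ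
Tri x y z h = Alt (x ∸ 1) z (Alt (y ∸ 1) x (Alt (z ∸ 1) y h))

Pair³-Tri : ∀ {x y z} → Odd x → Odd y → Odd z → ∀ h →
  Pair z (Pair x (Pair y (Tri x y z h))) ≗ Pair (x ℕ.* z) (Pair (y ℕ.* x) (Pair (z ℕ.* y) h))
Pair³-Tri {x} {y} {z} ox oy oz h e = begin
  Pair z (Pair x (Pair y (Alt X z (Alt Y x (Alt Z y h))))) e
    ≡⟨ Pair-cong z (Pair-cong x (Pair-Alt-comm y X z (Alt Y x (Alt Z y h)))) e ⟩
  Pair z (Pair x (Alt X z (Pair y (Alt Y x (Alt Z y h))))) e
    ≡⟨ Pair-cong z (Pair-cong x (Alt-cong X z (Pair-Alt-comm y Y x (Alt Z y h)))) e ⟩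
  Pair z (Pair x (Alt X z (Alt Y x (Pair y (Alt Z y h))))) e
    ≡⟨ Pair-cong z (Pair-cong x (Alt-cong X z (Alt-cong Y x (Pair-Alt oz y h)))) e ⟩
  Pair z (Pair x (Alt X z (Alt Y x (Pair (z ℕ.* y) h)))) e
    ≡⟨ Pair-cong z (Pair-Alt-comm x X z (Alt Y x (Pair (z ℕ.* y) h))) e ⟩
  Pair z (Alt X z (Pair x (Alt Y x (Pair (z ℕ.* y) h)))) e
    ≡⟨ Pair-cong z (Alt-cong X z (Pair-Alt oy x (Pair (z ℕ.* y) h))) e ⟩
  Pair z (Alt X z (Pair (y ℕ.* x) (Pair (z ℕ.* y) h))) e
    ≡⟨ Pair-Alt ox z (Pair (y ℕ.* x) (Pair (z ℕ.* y) h)) e ⟩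
  Pair (x ℕ.* z) (Pair (y ℕ.* x) (Pair (z ℕ.* y) h)) e   ∎
  where
  X = x ∸ 1
  Y = y ∸ 1
  Z = z ∸ 1

Pair³-Tri-swapped : ∀ {x y z} → Odd x → Odd y → Odd z → ∀ h →
  Pair z (Pair x (Pair y (Tri x y z h))) ≗ Pair z (Pair x (Pair y (Tri x z y h)))
Pair³-Tri-swapped {x} {y} {z} ox oy oz h e = begin
  Pair z (Pair x (Pair y (Tri x y z h))) e
    ≡⟨ Pair³-Tri ox oy oz h e ⟩
  Pair (x ℕ.* z) (Pair (y ℕ.* x) (Pair (z ℕ.* y) h)) e
    ≡⟨ cong₃ (λ p q r → Pair p (Pair q (Pair r h)) e) (ℕP.*-comm x z) (ℕP.*-comm y x) (ℕP.*-comm z y) ⟩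
  Pair (z ℕ.* x) (Pair (x ℕ.* y) (Pair (y ℕ.* z) h)) e
    ≡⟨ Pair-comm (z ℕ.* x) (x ℕ.* y) (Pair (y ℕ.* z) h) e ⟩
  Pair (x ℕ.* y) (Pair (z ℕ.* x) (Pair (y ℕ.* z) h)) e
    ≡⟨ Pair³-Tri ox oz oy h e ⟨
  Pair y (Pair x (Pair z (Tri x z y h))) e
    ≡⟨ Pair³-reverse y x z (Tri x z y h) e ⟩
  Pair z (Pair x (Pair y (Tri x z y h))) e   ∎
  where
  cong₃ : ∀ (f : ℕ → ℕ → ℕ → ℤ) {p p′ q q′ r r′} → p ≡ p′ → q ≡ q′ → r ≡ r′ → f p q r ≡ f p′ q′ r′
  cong₃ f refl refl refl = refl

VanishesBeyond : ℕ → (ℕ → ℤ) → Set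
VanishesBeyond N h = ∀ e → N < e → h e ≡ 0ℤ

Alt-vanishes : ∀ {N} M c {h} → VanishesBeyond N h → VanishesBeyond N (Alt M c h)
Alt-vanishes M c {h} v e N<e = altSum-zero M (λ a → h (e ℕ.+ a ℕ.* c))
  (λ a → v _ (ℕP.<-≤-trans N<e (ℕP.m≤m+n e (a ℕ.* c))))

Pair-vanishes : ∀ {N} c {h} → VanishesBeyond N h → VanishesBeyond N (Pair c h)
Pair-vanishes c v e N<e = cong₂ _+_ (v e N<e) (v _ (ℕP.<-≤-trans N<e (ℕP.m≤m+n e c)))

Tri-vanishes : ∀ {N} x y z {h} → VanishesBeyond N h → VanishesBeyond N (Tri x y z h)
Tri-vanishes x y z v = Alt-vanishes (x ∸ 1) z (Alt-vanishes (y ∸ 1) x (Alt-vanishes (z ∸ 1) y v))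

-- For c > 0, Pair c is injective on functions vanishing beyond N: since
-- F e = Pair c F e - F (e + c), the values are determined from the top down.
Pair-injective : ∀ {N c F G} → 0 < c → VanishesBeyond N F → VanishesBeyond N G →
  Pair c F ≗ Pair c G → F ≗ G
Pair-injective {N} {c} {F} {G} c>0 vF vG PF≗PG e =
  downward (suc N) e (ℕP.<-≤-trans (ℕP.n<1+n N) (ℕP.m≤n+m (suc N) e))
  where
  -- induction on the distance m from e to the region beyond N
  downward : ∀ m e → N < e ℕ.+ m → F e ≡ G e
  downward zero e N<e+0 = trans (vF e N<e) (sym (vG e N<e))
    where
    N<e : N < e
    N<e = subst (N <_) (ℕP.+-identityʳ e) N<e+0
  downward (suc m) e N<e+1+m =
    ∙-cancelʳ (F (e ℕ.+ c)) (F e) (G e) (trans (PF≗PG e) (cong (λ t → G e + t) (sym F≡G-above)))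
    where
    e+1+m≤e+c+m : e ℕ.+ suc m ≤ e ℕ.+ c ℕ.+ m
    e+1+m≤e+c+m = subst (_≤ e ℕ.+ c ℕ.+ m) (ℕP.+-assoc e 1 m) (ℕP.+-monoˡ-≤ m (ℕP.+-monoʳ-≤ e c>0))
    F≡G-above : F (e ℕ.+ c) ≡ G (e ℕ.+ c)
    F≡G-above = downward m (e ℕ.+ c) (ℕP.<-≤-trans N<e+1+m e+1+m≤e+c+m)

Pair³-injective : ∀ {N a b c F G} → 0 < a → 0 < b → 0 < c →
  VanishesBeyond N F → VanishesBeyond N G →
  Pair a (Pair b (Pair c F)) ≗ Pair a (Pair b (Pair c G)) → F ≗ G
Pair³-injective {a = a} {b} {c} a>0 b>0 c>0 vF vG eq =
  Pair-injective c>0 vF vG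
    (Pair-injective b>0 (Pair-vanishes c vF) (Pair-vanishes c vG)
      (Pair-injective a>0 (Pair-vanishes b (Pair-vanishes c vF)) (Pair-vanishes b (Pair-vanishes c vG)) eq))

Tri-symmetric-vanishing : ∀ {x y z N h} → Odd x → Odd y → Odd z → VanishesBeyond N h →
  Tri x y z h ≗ Tri x z y h
Tri-symmetric-vanishing {x} {y} {z} {h = h} ox oy oz v =
  Pair³-injective (odd-pos oz) (odd-pos ox) (odd-pos oy)
    (Tri-vanishes x y z v) (Tri-vanishes x z y v) (Pair³-Tri-swapped ox oy oz h)

Alt-local : ∀ M N c {h h′ : ℕ → ℤ} → (∀ e → e ≤ M ℕ.+ N ℕ.* c → h e ≡ h′ e) →
  ∀ e → e ≤ M → Alt N c h e ≡ Alt N c h′ e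
Alt-local M N c eq e e≤M = altSum-cong≤ N (λ a a≤N → eq _ (ℕP.+-mono-≤ e≤M (ℕP.*-monoˡ-≤ c a≤N)))

-- the largest argument of h used by Tri x y z h 0
reach : ℕ → ℕ → ℕ → ℕ
reach x y z = (x ∸ 1) ℕ.* z ℕ.+ (y ∸ 1) ℕ.* x ℕ.+ (z ∸ 1) ℕ.* y

Tri-local : ∀ x y z {h h′ : ℕ → ℤ} → (∀ e → e ≤ reach x y z → h e ≡ h′ e) →
  Tri x y z h 0 ≡ Tri x y z h′ 0
Tri-local x y z eq =
  Alt-local 0 (x ∸ 1) z (Alt-local M₁ (y ∸ 1) x (Alt-local (M₁ ℕ.+ (y ∸ 1) ℕ.* x) (z ∸ 1) y eq)) 0 z≤n
  where
  M₁ = (x ∸ 1) ℕ.* z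

truncate : ℕ → (ℕ → ℤ) → ℕ → ℤ
truncate N g e with e ≤? N
... | yes _ = g e
... | no  _ = 0ℤ

truncate-vanishes : ∀ N g → VanishesBeyond N (truncate N g)
truncate-vanishes N g e N<e with e ≤? N
... | yes e≤N = ⊥-elim (ℕP.<⇒≱ N<e e≤N)
... | no  _   = refl

truncate-agrees : ∀ N g e → e ≤ N → truncate N g e ≡ g e
truncate-agrees N g e e≤N with e ≤? N
... | yes _   = refl
... | no  e≰N = ⊥-elim (e≰N e≤N)

-- The symmetry, for arbitrary g: truncate g beyond everything Tri looks at.
Tri-symmetric : ∀ {x y z} → Odd x → Odd y → Odd z → ∀ g → Tri x y z g 0 ≡ Tri x z y g 0
Tri-symmetric {x} {y} {z} ox oy oz g = begin
  Tri x y z g 0    ≡⟨ Tri-local x y z (λ e e≤ → truncate-agrees B g e (ℕP.m≤n⇒m≤n+o (reach x z y) e≤)) ⟨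
  Tri x y z g′ 0   ≡⟨ Tri-symmetric-vanishing ox oy oz (truncate-vanishes B g) 0 ⟩
  Tri x z y g′ 0   ≡⟨ Tri-local x z y (λ e e≤ → truncate-agrees B g e (ℕP.m≤n⇒m≤o+n (reach x y z) e≤)) ⟩
  Tri x z y g 0    ∎
  where
  B  = reach x y z ℕ.+ reach x z y
  g′ = truncate B g

-- Expansion of the sums of the theorem

T-scaled : ∀ k N c → T k N * + (c ^ k) ≡ altSum N (λ i → (+ (i ℕ.* c)) ^ᶻ k)
T-scaled k N c = begin
  T k N * + (c ^ k)                             ≡⟨ cong₂ _*_ (T-altSum k N) (pos-^ c k) ⟩
  altSum N (λ i → + (i ^ k)) * (+ c) ^ᶻ k       ≡⟨ altSum-*ʳ N ((+ c) ^ᶻ k) (λ i → + (i ^ k)) ⟩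
  altSum N (λ i → + (i ^ k) * (+ c) ^ᶻ k)       ≡⟨ altSum-cong N power-of-product ⟩
  altSum N (λ i → (+ (i ℕ.* c)) ^ᶻ k)           ∎
  where
  power-of-product : ∀ i → + (i ^ k) * (+ c) ^ᶻ k ≡ (+ (i ℕ.* c)) ^ᶻ k
  power-of-product i = begin
    + (i ^ k) * (+ c) ^ᶻ k    ≡⟨ cong (_* (+ c) ^ᶻ k) (pos-^ i k) ⟩
    (+ i) ^ᶻ k * (+ c) ^ᶻ k   ≡⟨ ^-distrib-* (+ i) (+ c) k ⟨
    (+ i * + c) ^ᶻ k          ≡⟨ cong (_^ᶻ k) (ℤP.pos-* i c) ⟨
    (+ (i ℕ.* c)) ^ᶻ k        ∎

altSum-* : ∀ M N (f g : ℕ → ℤ) → altSum M f * altSum N g ≡ altSum M (λ i → altSum N (λ j → f i * g j))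
altSum-* M N f g = trans (altSum-*ʳ M (altSum N g) f) (altSum-cong M (λ i → altSum-*ˡ N (f i) g))

altSum-*³ : ∀ (y : ℤ) N₁ N₂ N₃ (f₁ f₂ f₃ : ℕ → ℤ) →
  y * altSum N₁ f₁ * altSum N₂ f₂ * altSum N₃ f₃
    ≡ altSum N₁ (λ i → altSum N₂ (λ j → altSum N₃ (λ h → y * f₁ i * f₂ j * f₃ h)))
altSum-*³ y N₁ N₂ N₃ f₁ f₂ f₃ = begin
  y * altSum N₁ f₁ * altSum N₂ f₂ * altSum N₃ f₃
    ≡⟨ cong (λ t → t * altSum N₂ f₂ * altSum N₃ f₃) (altSum-*ˡ N₁ y f₁) ⟩
  altSum N₁ (λ i → y * f₁ i) * altSum N₂ f₂ * altSum N₃ f₃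
    ≡⟨ cong (_* altSum N₃ f₃) (altSum-* N₁ N₂ (λ i → y * f₁ i) f₂) ⟩
  altSum N₁ (λ i → altSum N₂ (λ j → y * f₁ i * f₂ j)) * altSum N₃ f₃
    ≡⟨ altSum-*ʳ N₁ (altSum N₃ f₃) (λ i → altSum N₂ (λ j → y * f₁ i * f₂ j)) ⟩
  altSum N₁ (λ i → altSum N₂ (λ j → y * f₁ i * f₂ j) * altSum N₃ f₃)
    ≡⟨ altSum-cong N₁ (λ i → altSum-* N₂ N₃ (λ j → y * f₁ i * f₂ j) f₃) ⟩
  altSum N₁ (λ i → altSum N₂ (λ j → altSum N₃ (λ h → y * f₁ i * f₂ j * f₃ h)))   ∎

pos-trinomial : ∀ n a b c → (+ a + + b + + c) ^ᶻ n ≡ + ((a ℕ.+ b ℕ.+ c) ^ n)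
pos-trinomial n a b c = begin
  (+ a + + b + + c) ^ᶻ n       ≡⟨ cong (λ t → (t + + c) ^ᶻ n) (ℤP.pos-+ a b) ⟨
  (+ (a ℕ.+ b) + + c) ^ᶻ n     ≡⟨ cong (_^ᶻ n) (ℤP.pos-+ (a ℕ.+ b) c) ⟨
  (+ (a ℕ.+ b ℕ.+ c)) ^ᶻ n     ≡⟨ pos-^ (a ℕ.+ b ℕ.+ c) n ⟨
  + ((a ℕ.+ b ℕ.+ c) ^ n)      ∎

expansion : ∀ n N₁ N₂ N₃ c₁ c₂ c₃ →
  sumTriples n (λ k l m → + multinomial n k l m * T k N₁ * T l N₂ * T m N₃ * + (c₁ ^ k) * + (c₂ ^ l) * + (c₃ ^ m))
    ≡ Alt N₁ c₁ (Alt N₂ c₂ (Alt N₃ c₃ (λ e → + (e ^ n)))) 0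
expansion n N₁ N₂ N₃ c₁ c₂ c₃ = begin
  sumTriples n F
    ≡⟨ sumTriples-∑△ n F ⟩
  ∑△ n (λ k l → F k l (n ∸ k ∸ l))
    ≡⟨ ∑△-cong n (λ k l → expand-term k l (n ∸ k ∸ l)) ⟩
  ∑△ n (λ k l → altSum N₁ (λ i → altSum N₂ (λ j → altSum N₃ (λ h → term i j h k l))))
    ≡⟨ ∑△-altSum n N₁ (λ i k l → altSum N₂ (λ j → altSum N₃ (λ h → term i j h k l))) ⟩
  altSum N₁ (λ i → ∑△ n (λ k l → altSum N₂ (λ j → altSum N₃ (λ h → term i j h k l))))
    ≡⟨ altSum-cong N₁ level₂ ⟩
  Alt N₁ c₁ (Alt N₂ c₂ (Alt N₃ c₃ g)) 0   ∎
  where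
  g : ℕ → ℤ
  g e = + (e ^ n)
  F : ℕ → ℕ → ℕ → ℤ
  F k l m = + multinomial n k l m * T k N₁ * T l N₂ * T m N₃ * + (c₁ ^ k) * + (c₂ ^ l) * + (c₃ ^ m)
  X Y Z : ℕ → ℤ
  X i = + (i ℕ.* c₁)
  Y j = + (j ℕ.* c₂)
  Z h = + (h ℕ.* c₃)
  term : ℕ → ℕ → ℕ → ℕ → ℕ → ℤ
  term i j h k l = + multinomial n k l (n ∸ k ∸ l) * X i ^ᶻ k * Y j ^ᶻ l * Z h ^ᶻ (n ∸ k ∸ l)
  regroup : ∀ y t₁ t₂ t₃ p₁ p₂ p₃ → y * t₁ * t₂ * t₃ * p₁ * p₂ * p₃ ≡ y * (t₁ * p₁) * (t₂ * p₂) * (t₃ * p₃)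
  regroup = solve-∀
  expand-term : ∀ k l m → F k l m
    ≡ altSum N₁ (λ i → altSum N₂ (λ j → altSum N₃ (λ h → + multinomial n k l m * X i ^ᶻ k * Y j ^ᶻ l * Z h ^ᶻ m)))
  expand-term k l m = begin
    F k l m
      ≡⟨ regroup (+ multinomial n k l m) (T k N₁) (T l N₂) (T m N₃) (+ (c₁ ^ k)) (+ (c₂ ^ l)) (+ (c₃ ^ m)) ⟩
    + multinomial n k l m * (T k N₁ * + (c₁ ^ k)) * (T l N₂ * + (c₂ ^ l)) * (T m N₃ * + (c₃ ^ m))
      ≡⟨ cong₂ _*_ (cong₂ _*_ (cong (λ t → + multinomial n k l m * t) (T-scaled k N₁ c₁)) (T-scaled l N₂ c₂))
                   (T-scaled m N₃ c₃) ⟩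
    + multinomial n k l m * altSum N₁ (λ i → X i ^ᶻ k) * altSum N₂ (λ j → Y j ^ᶻ l) * altSum N₃ (λ h → Z h ^ᶻ m)
      ≡⟨ altSum-*³ (+ multinomial n k l m) N₁ N₂ N₃ (λ i → X i ^ᶻ k) (λ j → Y j ^ᶻ l) (λ h → Z h ^ᶻ m) ⟩
    altSum N₁ (λ i → altSum N₂ (λ j → altSum N₃ (λ h → + multinomial n k l m * X i ^ᶻ k * Y j ^ᶻ l * Z h ^ᶻ m)))   ∎
  trinomial-term : ∀ i j h → ∑△ n (term i j h) ≡ g (i ℕ.* c₁ ℕ.+ j ℕ.* c₂ ℕ.+ h ℕ.* c₃)
  trinomial-term i j h = trans (trinomial n (X i) (Y j) (Z h)) (pos-trinomial n (i ℕ.* c₁) (j ℕ.* c₂) (h ℕ.* c₃))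
  level₃ : ∀ i j → ∑△ n (λ k l → altSum N₃ (λ h → term i j h k l)) ≡ Alt N₃ c₃ g (i ℕ.* c₁ ℕ.+ j ℕ.* c₂)
  level₃ i j = trans (∑△-altSum n N₃ (term i j)) (altSum-cong N₃ (trinomial-term i j))
  level₂ : ∀ i → ∑△ n (λ k l → altSum N₂ (λ j → altSum N₃ (λ h → term i j h k l)))
    ≡ Alt N₂ c₂ (Alt N₃ c₃ g) (i ℕ.* c₁)
  level₂ i = trans (∑△-altSum n N₂ (λ j k l → altSum N₃ (λ h → term i j h k l))) (altSum-cong N₂ (level₃ i))

theorem17 : (w₁ w₂ w₃ n : ℕ) → Odd w₁ → Odd w₂ → Odd w₃ →
    sumTriples n (λ k l m → + multinomial n k l m * T k (w₁ ∸ 1) * T l (w₂ ∸ 1) * T m (w₃ ∸ 1) * + (w₃ ^ k) * + (w₁ ^ l) * + (w₂ ^ m))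
      ≡ sumTriples n (λ k l m → + multinomial n k l m * T k (w₁ ∸ 1) * T l (w₃ ∸ 1) * T m (w₂ ∸ 1) * + (w₂ ^ k) * + (w₁ ^ l) * + (w₃ ^ m))
theorem17 w₁ w₂ w₃ n o₁ o₂ o₃ =
  trans (expansion n (w₁ ∸ 1) (w₂ ∸ 1) (w₃ ∸ 1) w₃ w₁ w₂)      -- left side = Tri w₁ w₂ w₃ g 0
    (trans (Tri-symmetric o₁ o₂ o₃ g)                           --           = Tri w₁ w₃ w₂ g 0
      (sym (expansion n (w₁ ∸ 1) (w₃ ∸ 1) (w₂ ∸ 1) w₂ w₁ w₃)))  --           = right side
  where
  g : ℕ → ℤ
  g e = + (e ^ n)
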